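{- Let $\mathcal{S}$ be a set of $\{0,1\}$-valued sequences. Then $\mathcal{S}$ has uniformly bounded jumps if and only if $\mathcal{S}$ converges abstractly $\omega$-uniformly.
   Context: A sequence is $\bar a=(a_n)_{n\in\mathbb{N}}$ with $a_n\in\{0,1\}$. $\mathcal{S}$ has uniformly bounded jumps if there is $k$ such that whenever $\bar a\in\mathcal{S}$ and $n_0<\cdots<n_k$, there is $i<k$ with $a_{n_i}=a_{n_{i+1}}$. $T_{\mathcal{S}}$ is the tree of finite strictly increasing sequences $0<r_1<\cdots<r_M$ ($M\ge 0$) such that, setting $r_0=0$, there is some $\bar a\in\mathcal{S}$ such that for every $i<M$ there are $n_0,n_1\in[r_i,r_{i+1}]$ with $a_{n_0}=0$ and $a_{n_1}=1$. Height of a tree $T$ (a set of finite sequences closed under initial segments): if $T$ has no infinite branch, define $\rho_T(s)=\sup\{\rho_T(t)+1: t\in T\text{ an immediate extension of }s\}$ and the height of $T$ is $\sup\{\rho_T(s)+1:s\in T\}$; if $T$ has an infinite branch its height exceeds every ordinal. $\mathcal{S}$ converges abstractly $\omega$-uniformly if $T_{\mathcal{S}}$ has height strictly less than $\omega$. -}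

module Defs where

open import Data.Nat using (ℕ; zero; suc; _<_; _≤_)
open import Data.Bool using (Bool; true; false)
open import Data.Fin using (Fin; inject₁) renaming (suc to fsuc)
open import Data.List using (List; []; _∷_; _∷ʳ_)
open import Data.Product using (Σ; ∃; ∃-syntax; _×_)
open import Data.Unit using (⊤)
open import Relation.Nullary using (¬_)
open import Relation.Binary.PropositionalEquality using (_≡_)

-- A {0,1}-valued sequence; the value 0 is encoded as false, 1 as true.
Seq : Set
Seq = ℕ → Bool

SeqSet : Set₁
SeqSet = Seq → Set

UniformlyBoundedJumps : SeqSet → Set
UniformlyBoundedJumps S =
  ∃[ k ] ∀ (a : Seq) → S a →
    ∀ (n : Fin (suc k) → ℕ) →
    (∀ (i : Fin k) → n (inject₁ i) < n (fsuc i)) →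
    ∃[ i ] (a (n (inject₁ i)) ≡ a (n (fsuc i)))

Tree : Set₁
Tree = List ℕ → Set

Increasing : ℕ → List ℕ → Set
Increasing p []       = ⊤
Increasing p (r ∷ rs) = p < r × Increasing r rs

Oscillates : Seq → ℕ → List ℕ → Set
Oscillates a p []       = ⊤
Oscillates a p (r ∷ rs) =
  (∃[ n₀ ] (p ≤ n₀ × n₀ ≤ r × a n₀ ≡ false)) ×
  (∃[ n₁ ] (p ≤ n₁ × n₁ ≤ r × a n₁ ≡ true)) ×
  Oscillates a r rs

T : SeqSet → Tree
T S rs = Increasing 0 rs × ∃[ a ] (S a × Oscillates a 0 rs)

-- RankLe Tr s n  expresses  ρ_T(s) ≤ n  (for a finite n), unfolding
-- ρ_T(s) = sup { ρ_T(t) + 1 : t ∈ T immediate extension of s }: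
--   ρ(s) ≤ 0      iff s has no immediate extension in T;
--   ρ(s) ≤ n + 1  iff every immediate extension t ∈ T has ρ(t) ≤ n.
RankLe : Tree → List ℕ → ℕ → Set
RankLe Tr s zero    = ∀ (x : ℕ) → ¬ Tr (s ∷ʳ x)
RankLe Tr s (suc n) = ∀ (x : ℕ) → Tr (s ∷ʳ x) → RankLe Tr (s ∷ʳ x) n

-- HeightLe Tr m expresses  height(T) = sup { ρ_T(s) + 1 : s ∈ T } ≤ m.
HeightLe : Tree → ℕ → Set
HeightLe Tr zero    = ∀ (s : List ℕ) → ¬ Tr s
HeightLe Tr (suc n) = ∀ (s : List ℕ) → Tr s → RankLe Tr s n

HeightBelowω : Tree → Set
HeightBelowω Tr = ∃[ m ] HeightLe Tr m

ConvergesAbstractlyωUniformly : SeqSet → Set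
ConvergesAbstractlyωUniformly S = HeightBelowω (T S)

-- If a ∈ S alternates along n₀ < n₁ < ⋯ < n_{2M} (a n_j ≠ a n_{j+1}), then a oscillates on
-- each interval [n_{2i}, n_{2i+2}], which gives a node of T_S of length M. Conversely, a node
-- r₁ < ⋯ < r_M witnessed by a yields an alternating chain of length M, choosing in each
-- interval [r_i, r_{i+1}] a point where a differs from the previously chosen one. So both
-- properties say that the alternating chains of members of S have bounded length; and as T_S
-- is closed under initial segments, its height is finite exactly when its nodes have bounded length.
module Submission where

open import Defs
open import Function.Bundles using (_⇔_; mk⇔)
open import Data.Nat
open import Data.Nat.Properties
open import Data.Bool using (Bool; true; false)
open import Data.Bool.Properties using () renaming (_≟_ to _≟ᵇ_)
open import Data.Fin using (Fin; toℕ; fromℕ<; inject₁) renaming (suc to fsuc)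
open import Data.Fin.Properties using (toℕ-fromℕ<; fromℕ<-toℕ; toℕ-inject₁; toℕ<n; any?)
open import Data.List using (List; []; _∷_; _++_; _∷ʳ_; length)
open import Data.List.Properties using (length-++; ∷ʳ-++)
open import Data.Product using (_×_; _,_; proj₁; proj₂; ∃-syntax)
open import Data.Unit using (tt)
open import Function.Base using (_∘′_)
open import Relation.Nullary using (¬_; yes; no; contradiction)
open import Relation.Binary.PropositionalEquality

DepthBound : Tree → ℕ → Set
DepthBound Tr B = ∀ rs → Tr rs → length rs < B

PrefixClosed : Tree → Set
PrefixClosed Tr = ∀ u v → Tr (u ++ v) → Tr u

depthBound⇒rankLe : ∀ {Tr B} → DepthBound Tr B →
  ∀ n s → B ≤ length s + suc n → RankLe Tr s n
depthBound⇒rankLe {B = B} bound zero s B≤ x t =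
  <⇒≱ (bound _ t) (subst (B ≤_) (sym (length-++ s)) B≤)
depthBound⇒rankLe {B = B} bound (suc n) s B≤ x t =
  depthBound⇒rankLe bound n (s ∷ʳ x) (subst (B ≤_) length-shift B≤)
  where
  length-shift : length s + suc (suc n) ≡ length (s ∷ʳ x) + suc n
  length-shift = trans (sym (+-assoc (length s) 1 (suc n))) (cong (_+ suc n) (sym (length-++ s)))

depthBound⇒heightLe : ∀ {Tr B} → DepthBound Tr B → HeightLe Tr B
depthBound⇒heightLe {B = zero}  bound s t = contradiction (bound s t) λ ()
depthBound⇒heightLe {B = suc n} bound s t = depthBound⇒rankLe bound n s (m≤n+m (suc n) (length s))

rankLe-bounds-extensions : ∀ {Tr} → PrefixClosed Tr →
  ∀ {n s} t → RankLe Tr s n → Tr (s ++ t) → length t ≤ n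
rankLe-bounds-extensions pc [] _ _ = z≤n
rankLe-bounds-extensions {Tr} pc {n} {s} (x ∷ t) rank st = extend n rank
  where
  sxt : Tr (s ∷ʳ x ++ t)
  sxt = subst Tr (sym (∷ʳ-++ s x t)) st

  extend : ∀ n → RankLe Tr s n → suc (length t) ≤ n
  extend zero    rank = contradiction (pc (s ∷ʳ x) t sxt) (rank x)
  extend (suc n) rank = s≤s (rankLe-bounds-extensions pc t (rank x (pc _ t sxt)) sxt)

heightLe⇒depthBound : ∀ {Tr} → PrefixClosed Tr → ∀ {m} → HeightLe Tr m → DepthBound Tr m
heightLe⇒depthBound pc {zero}  height rs t = contradiction t (height rs)
heightLe⇒depthBound pc {suc n} height rs t =
  s≤s (rankLe-bounds-extensions pc rs (height [] (pc [] rs t)) t)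

T-prefixClosed : (S : SeqSet) → PrefixClosed (T S)
T-prefixClosed S u v (inc , a , Sa , osc) = increasing-prefix 0 u inc , a , Sa , oscillates-prefix 0 u osc
  where
  increasing-prefix : ∀ p u → Increasing p (u ++ v) → Increasing p u
  increasing-prefix p []      _         = tt
  increasing-prefix p (r ∷ u) (p<r , i) = p<r , increasing-prefix r u i

  oscillates-prefix : ∀ p u → Oscillates a p (u ++ v) → Oscillates a p u
  oscillates-prefix p []      _              = tt
  oscillates-prefix p (r ∷ u) (o₀ , o₁ , os) = o₀ , o₁ , oscillates-prefix r u os

AlternatingChain : Seq → (ℕ → ℕ) → ℕ → Set
AlternatingChain a f len = ∀ i → i < len → f i < f (suc i) × a (f i) ≢ a (f (suc i))

AlternationBound : SeqSet → ℕ → Set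
AlternationBound S k = ∀ a → S a → ∀ f → ¬ AlternatingChain a f k

AlternatingChainFrom : Seq → ℕ → ℕ → Set
AlternatingChainFrom a x len = ∃[ f ] (f 0 ≡ x × AlternatingChain a f len)

Attains : Seq → ℕ → ℕ → Bool → Set
Attains a p r b = ∃[ n ] (p ≤ n × n ≤ r × a n ≡ b)

alternatingChain-weaken : ∀ {a f k len} → k ≤ len → AlternatingChain a f len → AlternatingChain a f k
alternatingChain-weaken k≤len chain i i<k = chain i (≤-trans i<k k≤len)

alternatingChain-cons : ∀ {a x y len} → x < y → a x ≢ a y →
  AlternatingChainFrom a y len → AlternatingChainFrom a x (suc len)
alternatingChain-cons {a} {x} {y} {len} x<y ax≢ay (g , refl , chain) = f , refl , step
  where
  f : ℕ → ℕ
  f zero    = x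
  f (suc i) = g i

  step : AlternatingChain a f (suc len)
  step zero    _           = x<y , ax≢ay
  step (suc i) (s≤s i<len) = chain i i<len

attains-both⇒≢-value : ∀ {a p r} x → Attains a p r false → Attains a p r true →
  ∃[ y ] (p ≤ y × y ≤ r × a x ≢ a y)
attains-both⇒≢-value {a} x (n₀ , p≤n₀ , n₀≤r , a₀) (n₁ , p≤n₁ , n₁≤r , a₁) with a x
... | true  = n₀ , p≤n₀ , n₀≤r , λ eq → contradiction (trans eq a₀) λ ()
... | false = n₁ , p≤n₁ , n₁≤r , λ eq → contradiction (trans eq a₁) λ ()

oscillates⇒alternatingChain : ∀ {a} rs {p x} → x ≤ p → Oscillates a p rs →
  AlternatingChainFrom a x (length rs)
oscillates⇒alternatingChain       []       {x = x} _   _              = (λ _ → x) , refl , λ _ ()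
oscillates⇒alternatingChain {a} (r ∷ rs) {x = x} x≤p (o₀ , o₁ , os) with attains-both⇒≢-value x o₀ o₁
... | y , p≤y , y≤r , ax≢ay =
  alternatingChain-cons (≤∧≢⇒< (≤-trans x≤p p≤y) (ax≢ay ∘′ cong a)) ax≢ay
    (oscillates⇒alternatingChain rs y≤r os)

alternatingChain-drop : ∀ {a f len} → AlternatingChain a f (suc len) → AlternatingChain a (f ∘′ suc) len
alternatingChain-drop chain i i<len = chain (suc i) (s≤s i<len)

≢-values⇒attains-both : ∀ {a p r x y} → p ≤ x → x ≤ r → p ≤ y → y ≤ r → a x ≢ a y →
  Attains a p r false × Attains a p r true
≢-values⇒attains-both {a} {x = x} {y} p≤x x≤r p≤y y≤r ax≢ay with a x in ax | a y in ay
... | false | true  = (x , p≤x , x≤r , ax) , (y , p≤y , y≤r , ay)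
... | true  | false = (y , p≤y , y≤r , ay) , (x , p≤x , x≤r , ax)
... | false | false = contradiction refl ax≢ay
... | true  | true  = contradiction refl ax≢ay

evenPoints : (ℕ → ℕ) → ℕ → List ℕ
evenPoints f zero    = []
evenPoints f (suc M) = f 2 ∷ evenPoints (λ i → f (2 + i)) M

length-evenPoints : ∀ f M → length (evenPoints f M) ≡ M
length-evenPoints f zero    = refl
length-evenPoints f (suc M) = cong suc (length-evenPoints _ M)

alternatingChain⇒oscillates : ∀ {a} M {f p} → p ≤ f 0 → AlternatingChain a f (M + M) →
  Increasing p (evenPoints f M) × Oscillates a p (evenPoints f M)
alternatingChain⇒oscillates zero    _    _     = tt , tt
alternatingChain⇒oscillates {a} (suc M) {f} p≤f0 chain =
  (p<f2 , proj₁ rest) , proj₁ oscillation , proj₂ oscillation , proj₂ rest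
  where
  chain′ : AlternatingChain a f (2 + (M + M))
  chain′ = subst (AlternatingChain a f) (cong suc (+-suc M M)) chain

  f0<f1 = proj₁ (chain′ 0 (s≤s z≤n))
  af0≢af1 = proj₂ (chain′ 0 (s≤s z≤n))
  f1<f2 = proj₁ (chain′ 1 (s≤s (s≤s z≤n)))
  p<f2 = ≤-<-trans p≤f0 (<-trans f0<f1 f1<f2)
  oscillation = ≢-values⇒attains-both p≤f0 (<⇒≤ (<-trans f0<f1 f1<f2))
                  (≤-trans p≤f0 (<⇒≤ f0<f1)) (<⇒≤ f1<f2) af0≢af1
  rest = alternatingChain⇒oscillates M ≤-refl
           (alternatingChain-drop {a} (alternatingChain-drop {a} chain′))

alternationBound⇒depthBound : ∀ {S k} → AlternationBound S k → DepthBound (T S) k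
alternationBound⇒depthBound bound rs (_ , a , Sa , osc) with oscillates⇒alternatingChain rs z≤n osc
... | f , _ , chain = ≰⇒> λ k≤len → bound a Sa f (alternatingChain-weaken {a} k≤len chain)

depthBound⇒alternationBound : ∀ {S m} → DepthBound (T S) m → AlternationBound S (m + m)
depthBound⇒alternationBound {m = m} depth a Sa f chain with alternatingChain⇒oscillates m z≤n chain
... | inc , osc = <-irrefl (length-evenPoints f m) (depth (evenPoints f m) (inc , a , Sa , osc))

uniformlyBoundedJumps⇒alternationBound : ∀ {S} → UniformlyBoundedJumps S → ∃[ k ] AlternationBound S k
uniformlyBoundedJumps⇒alternationBound {S} (k , ubj) = k , noChain
  where
  noChain : ∀ a → S a → ∀ f → ¬ AlternatingChain a f k
  noChain a Sa f chain with ubj a Sa (f ∘′ toℕ) increasing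
    where
    increasing : ∀ i → f (toℕ (inject₁ i)) < f (suc (toℕ i))
    increasing i rewrite toℕ-inject₁ i = proj₁ (chain (toℕ i) (toℕ<n i))
  ... | i , repeat rewrite toℕ-inject₁ i = proj₂ (chain (toℕ i) (toℕ<n i)) repeat

extendByZero : ∀ {k} → (Fin (suc k) → ℕ) → ℕ → ℕ
extendByZero {k} n i with i <? suc k
... | yes i<  = n (fromℕ< i<)
... | no  _   = 0

extendByZero-toℕ : ∀ {k} (n : Fin (suc k) → ℕ) {i} j → toℕ j ≡ i → extendByZero n i ≡ n j
extendByZero-toℕ {k} n j refl with toℕ j <? suc k
... | yes j< = cong n (fromℕ<-toℕ j j<)
... | no  j≮ = contradiction (toℕ<n j) j≮

alternationBound⇒uniformlyBoundedJumps : ∀ {S k} → AlternationBound S k → UniformlyBoundedJumps S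
alternationBound⇒uniformlyBoundedJumps {S} {k} bound = k , repeat
  where
  repeat : ∀ a → S a → ∀ n → (∀ i → n (inject₁ i) < n (fsuc i)) →
    ∃[ i ] (a (n (inject₁ i)) ≡ a (n (fsuc i)))
  repeat a Sa n inc with any? (λ i → a (n (inject₁ i)) ≟ᵇ a (n (fsuc i)))
  ... | yes found = found
  ... | no  none  = contradiction chain (bound a Sa (extendByZero n))
    where
    chain : AlternatingChain a (extendByZero n) k
    chain i i<k =
      subst₂ (λ x y → x < y × a x ≢ a y) (sym at-i) (sym at-suc-i) (inc j , λ eq → none (j , eq))
      where
      j = fromℕ< i<k
      at-i = extendByZero-toℕ n (inject₁ j) (trans (toℕ-inject₁ j) (toℕ-fromℕ< i<k))
      at-suc-i = extendByZero-toℕ n (fsuc j) (cong suc (toℕ-fromℕ< i<k))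

mainTheorem2 : (S : SeqSet) → UniformlyBoundedJumps S ⇔ ConvergesAbstractlyωUniformly S
mainTheorem2 S = mk⇔ converges ubj
  where
  converges : UniformlyBoundedJumps S → ConvergesAbstractlyωUniformly S
  converges jumps with uniformlyBoundedJumps⇒alternationBound jumps
  ... | k , bound = k , depthBound⇒heightLe (alternationBound⇒depthBound bound)

  ubj : ConvergesAbstractlyωUniformly S → UniformlyBoundedJumps S
  ubj (m , height) =
    alternationBound⇒uniformlyBoundedJumps
      (depthBound⇒alternationBound (heightLe⇒depthBound (T-prefixClosed S) height))
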